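{- Let $x,y,z$ be commuting indeterminates and let $D_1,D_2$ be the derivations of $\mathbb Q[x,y,z]$ with $D_1(x)=D_1(y)=D_1(z)=xy$ and $D_2(x)=D_2(y)=D_2(z)=xyz$. Then for $n\ge1$, $$(D_2D_1)^n(x)=(D_2D_1)^n(y)=(D_2D_1)^n(z)=S_n(x,y,z),$$ where $(D_2D_1)^n$ denotes $n$-fold application of $D_1$ followed by $D_2$.
   Context: $M_n=\{\overline1,1,1,\overline2,2,2,\dots,\overline n,n,n\}$ with the total order $\overline1<1<\overline2<2<\cdots<\overline n<n$. A Jacobi-Stirling permutation of $M_n$ is a permutation $\pi_1\cdots\pi_{3n}$ of $M_n$ such that for each $i\in[n]$ all entries between the two occurrences of the unbarred $i$ are larger than $i$; $\mathrm{JSP}_n$ is the set of these. Set $\pi_0=\pi_{3n+1}=0$; for $0\le i\le 3n$, $i$ is an ascent, descent or plateau if $\pi_i<\pi_{i+1}$, $\pi_i>\pi_{i+1}$ or $\pi_i=\pi_{i+1}$, counted by $\mathrm{asc},\mathrm{des},\mathrm{plat}$. $S_n(x,y,z)=\sum_{\pi\in\mathrm{JSP}_n}x^{\mathrm{asc}(\pi)}y^{\mathrm{des}(\pi)}z^{\mathrm{plat}(\pi)}$. -}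

module Defs where

open import Data.Nat as ℕ using (ℕ; zero; suc)
open import Data.Bool using (Bool; true; false; _∧_; if_then_else_)
open import Data.List using (List; []; _∷_; _++_; map; concatMap; length)
open import Data.Integer using (+_)
open import Data.Rational using (ℚ; _/_; 0ℚ; 1ℚ; _+_; _*_)

-- Polynomials in x, y, z with rational coefficients, represented by their
-- coefficient functions: f a b c = coefficient of x^a y^b z^c.
-- (This is the ambient ring Q[[x,y,z]] ⊇ Q[x,y,z]; all operations below
-- restrict to the usual operations on Q[x,y,z].)

Poly : Set
Poly = ℕ → ℕ → ℕ → ℚ

ℕtoℚ : ℕ → ℚ
ℕtoℚ k = (+ k) / 1

sumTo : ℕ → (ℕ → ℚ) → ℚ
sumTo zero    f = f zero
sumTo (suc a) f = sumTo a f + f (suc a)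

_⊕_ : Poly → Poly → Poly
(f ⊕ g) a b c = f a b c + g a b c

_⊗_ : Poly → Poly → Poly
(f ⊗ g) a b c =
  sumTo a λ i → sumTo b λ j → sumTo c λ k →
    f i j k * g (a ℕ.∸ i) (b ℕ.∸ j) (c ℕ.∸ k)

infixl 6 _⊕_
infixl 7 _⊗_

isZero : ℕ → Bool
isZero zero    = true
isZero (suc _) = false

mono : ℕ → ℕ → ℕ → Poly
mono i j k a b c =
  if (ℕ._≡ᵇ_ a i ∧ ℕ._≡ᵇ_ b j ∧ ℕ._≡ᵇ_ c k) then 1ℚ else 0ℚ

X Y Z : Poly
X = mono 1 0 0
Y = mono 0 1 0
Z = mono 0 0 1

∂x ∂y ∂z : Poly → Poly
∂x f a b c = ℕtoℚ (suc a) * f (suc a) b c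
∂y f a b c = ℕtoℚ (suc b) * f a (suc b) c
∂z f a b c = ℕtoℚ (suc c) * f a b (suc c)

-- The unique derivation D of Q[x,y,z] with D(x) = hx, D(y) = hy, D(z) = hz
-- is D = hx ∂x + hy ∂y + hz ∂z.
derivation : Poly → Poly → Poly → Poly → Poly
derivation hx hy hz f = hx ⊗ ∂x f ⊕ hy ⊗ ∂y f ⊕ hz ⊗ ∂z f

D₁ D₂ : Poly → Poly
D₁ = derivation (X ⊗ Y) (X ⊗ Y) (X ⊗ Y)
D₂ = derivation (X ⊗ Y ⊗ Z) (X ⊗ Y ⊗ Z) (X ⊗ Y ⊗ Z)

iterD₂D₁ : ℕ → Poly → Poly
iterD₂D₁ zero    f = f
iterD₂D₁ (suc n) f = D₂ (D₁ (iterD₂D₁ n f))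

-- Encoding of M_n: barred i ↦ 2i-1, unbarred i ↦ 2i (i ∈ [n]); this is an
-- order embedding of  1̄ < 1 < 2̄ < 2 < ... < n̄ < n  into ℕ, and 0 is below all.
-- A permutation of the multiset M_n is a word over {1..2n} in which each odd
-- letter occurs once and each even letter occurs twice.

range : ℕ → List ℕ
range zero    = []
range (suc m) = range m ++ (suc m ∷ [])

words : ℕ → List ℕ → List (List ℕ)
words zero    A = [] ∷ []
words (suc k) A = concatMap (λ a → map (a ∷_) (words k A)) A

count : ℕ → List ℕ → ℕ
count v []       = 0
count v (u ∷ us) = if ℕ._≡ᵇ_ u v then suc (count v us) else count v us

all : {A : Set} → (A → Bool) → List A → Bool
all p []       = true
all p (x ∷ xs) = p x ∧ all p xs

dropUntil : ℕ → List ℕ → List ℕ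
dropUntil v []       = []
dropUntil v (u ∷ us) = if ℕ._≡ᵇ_ u v then us else dropUntil v us

takeUntil : ℕ → List ℕ → List ℕ
takeUntil v []       = []
takeUntil v (u ∷ us) = if ℕ._≡ᵇ_ u v then [] else u ∷ takeUntil v us

multM : ℕ → ℕ → ℕ
multM n v = if ℕ._≡ᵇ_ v 0 then 0 else
            if ℕ._<ᵇ_ (2 ℕ.* n) v then 0 else
            if isZero (v ℕ.% 2) then 2 else 1

isPermM : ℕ → List ℕ → Bool
isPermM n w = all (λ v → ℕ._≡ᵇ_ (count v w) (multM n v)) (range (2 ℕ.* n))

-- entries between the two occurrences of the unbarred i (code 2i)
between : ℕ → List ℕ → List ℕ
between v w = takeUntil v (dropUntil v w)

isJS : ℕ → List ℕ → Bool
isJS n w = all (λ i → all (λ u → ℕ._<ᵇ_ (2 ℕ.* i) u) (between (2 ℕ.* i) w))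
               (range n)

filterᵇ : {A : Set} → (A → Bool) → List A → List A
filterᵇ p []       = []
filterᵇ p (x ∷ xs) = if p x then x ∷ filterᵇ p xs else filterᵇ p xs

JSP : ℕ → List (List ℕ)
JSP n = filterᵇ (λ w → isPermM n w ∧ isJS n w)
                (words (3 ℕ.* n) (range (2 ℕ.* n)))

pad : List ℕ → List ℕ
pad w = 0 ∷ (w ++ (0 ∷ []))

ascL desL platL : List ℕ → ℕ
ascL (u ∷ v ∷ r) = (if ℕ._<ᵇ_ u v then 1 else 0) ℕ.+ ascL (v ∷ r)
ascL _ = 0
desL (u ∷ v ∷ r) = (if ℕ._<ᵇ_ v u then 1 else 0) ℕ.+ desL (v ∷ r)
desL _ = 0
platL (u ∷ v ∷ r) = (if ℕ._≡ᵇ_ u v then 1 else 0) ℕ.+ platL (v ∷ r)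
platL _ = 0

asc des plat : List ℕ → ℕ
asc w = ascL (pad w)
des w = desL (pad w)
plat w = platL (pad w)

S : ℕ → Poly
S n a b c = ℕtoℚ (length (filterᵇ
  (λ w → ℕ._≡ᵇ_ (asc w) a ∧ ℕ._≡ᵇ_ (des w) b ∧ ℕ._≡ᵇ_ (plat w) c) (JSP n)))

-- Both derivations multiply by a monomial after applying Δ = ∂x + ∂y + ∂z: D₁ = xy·Δ and
-- D₂ = xyz·Δ. A polynomial with coefficients in ℕ is a multiset of exponents, and Δ sends
-- x^a y^b z^c to a copies of x^(a-1) y^b z^c, b copies of x^a y^(b-1) z^c and c copies of
-- x^a y^b z^(c-1). Every word of JSP_{n+1} arises exactly once from a word of JSP_n by inserting
-- the new barred letter into one of its gaps and then the block of the two new unbarred letters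
-- into one of the gaps of the result. The new letters exceed all others, so inserting them into
-- the gap between p and u replaces the ascent, descent or plateau p u by an ascent and a descent
-- (and, for the block, a plateau). Summed over the gaps of a word with statistics (a, d, p) this
-- is Δ followed by multiplication by xy, resp. xyz, so the generating polynomial obeys
-- S_{n+1} = D₂ D₁ S_n, starting from S₀ = z. Finally D₁ x = D₁ y = D₁ z = xy.

module Submission where

open import Defs
open import Data.Nat using (ℕ; _≤_)
open import Data.Product using (_×_)
open import Relation.Binary.PropositionalEquality using (_≡_)

open import Data.Bool using (Bool; true; false; _∧_; not; if_then_else_; T)
open import Data.Bool.Properties using (∧-zeroʳ; ∧-conical; T-≡)
open import Data.Empty using (⊥; ⊥-elim)
import Data.Integer as ℤ
import Data.Integer.Properties as ℤ
open import Data.List using (List; []; _∷_; _++_; [_]; length; map; concatMap; replicate)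
import Data.List.Properties as List
open import Data.List.Membership.Propositional using (_∈_; _∉_; find; lose)
open import Data.List.Membership.Propositional.Properties
  using (∈-++⁻; ∈-++⁺ˡ; ∈-++⁺ʳ; ∈-map⁺; ∈-map⁻; ∈-concatMap⁺; ∈-concatMap⁻)
open import Data.List.Membership.Propositional.Properties.WithK using (unique∧set⇒bag)
open import Data.List.Relation.Binary.BagAndSetEquality using (∼bag⇒↭)
open import Data.List.Relation.Binary.Permutation.Propositional
  using (_↭_; prep; swap; ↭-sym; module PermutationReasoning)
import Data.List.Relation.Binary.Permutation.Propositional as ↭
open import Data.List.Relation.Binary.Permutation.Propositional.Properties
  using (map⁺; ++⁺; ++⁺ˡ; shifts) renaming (shift to ↭-shift)
open import Data.List.Relation.Unary.All using (All; []; _∷_)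
import Data.List.Relation.Unary.All as All
open import Data.List.Relation.Unary.AllPairs using ([]; _∷_)
open import Data.List.Relation.Unary.Any using (here; there)
open import Data.List.Relation.Unary.Unique.Propositional using (Unique)
import Data.List.Relation.Unary.Unique.Propositional.Properties as Unique
open import Data.Nat using (zero; suc; pred; _+_; _*_; _∸_; _<_; _<ᵇ_; _≡ᵇ_; z≤n; s≤s)
open import Data.Nat.Coprimality using (1-coprimeTo)
import Data.Nat.Coprimality as Coprime
open import Data.Nat.DivMod using (_%_; [m+kn]%n≡m%n)
import Data.Nat.Properties as ℕ
open import Algebra.Properties.CommutativeSemigroup ℕ.+-commutativeSemigroup using () renaming (x∙yz≈y∙xz to +-exchange)
open import Algebra.Properties.CommutativeSemigroup ℕ.*-commutativeSemigroup using () renaming (x∙yz≈y∙xz to *-exchange)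
open import Data.Nat.Tactic.RingSolver using (solve-∀)
open import Data.Product using (_,_; proj₁; proj₂; ∃; ∃₂; map₁; map₂)
open import Data.Rational as ℚ using (ℚ; mkℚ; 0ℚ; 1ℚ)
import Data.Rational.Properties as ℚ
open import Data.Sum using (_⊎_; inj₁; inj₂)
import Data.Sum as Sum
open import Function using (_∘_)
open import Function.Bundles using (Equivalence; mk⇔)
open import Relation.Binary.Definitions using (tri<; tri≈; tri>)
open import Relation.Binary.PropositionalEquality
  using (refl; sym; trans; cong; cong₂; subst; _≢_; module ≡-Reasoning)
open import Relation.Nullary using (¬_)

private
  variable
    A B : Set

≡ᵇ-refl : ∀ n → (n ≡ᵇ n) ≡ true
≡ᵇ-refl zero    = refl
≡ᵇ-refl (suc n) = ≡ᵇ-refl n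

≡ᵇ-sym : ∀ m n → (m ≡ᵇ n) ≡ (n ≡ᵇ m)
≡ᵇ-sym zero    zero    = refl
≡ᵇ-sym zero    (suc n) = refl
≡ᵇ-sym (suc m) zero    = refl
≡ᵇ-sym (suc m) (suc n) = ≡ᵇ-sym m n

≢⇒≡ᵇ-false : ∀ m n → m ≢ n → (m ≡ᵇ n) ≡ false
≢⇒≡ᵇ-false zero    zero    m≢n = ⊥-elim (m≢n refl)
≢⇒≡ᵇ-false zero    (suc n) _   = refl
≢⇒≡ᵇ-false (suc m) zero    _   = refl
≢⇒≡ᵇ-false (suc m) (suc n) m≢n = ≢⇒≡ᵇ-false m n (m≢n ∘ cong suc)

<ᵇ-true : ∀ {m n} → m < n → (m <ᵇ n) ≡ true
<ᵇ-true {m} {n} m<n with m <ᵇ n | ℕ.<⇒<ᵇ m<n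
... | true | _ = refl

<ᵇ-false : ∀ {m n} → ¬ m < n → (m <ᵇ n) ≡ false
<ᵇ-false {m} {n} m≮n with m <ᵇ n | ℕ.<ᵇ⇒< m n
... | false | _    = refl
... | true  | m<n = ⊥-elim (m≮n (m<n _))

-- Extensionally Data.Nat._≤ᵇ_, but defined by recursion on both arguments.
_≤ᵇ_ : ℕ → ℕ → Bool
zero  ≤ᵇ _     = true
suc _ ≤ᵇ zero  = false
suc i ≤ᵇ suc a = i ≤ᵇ a

≤ᵇ-refl : ∀ a → (a ≤ᵇ a) ≡ true
≤ᵇ-refl zero    = refl
≤ᵇ-refl (suc a) = ≤ᵇ-refl a

≤ᵇ-step : ∀ i a → (i ≤ᵇ a) ≡ true → (i ≤ᵇ suc a) ≡ true
≤ᵇ-step zero    a       _ = refl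
≤ᵇ-step (suc i) (suc a) p = ≤ᵇ-step i a p

≤ᵇ⇒≢suc : ∀ i a → (i ≤ᵇ a) ≡ true → suc a ≢ i
≤ᵇ⇒≢suc (suc i) (suc a) p q = ≤ᵇ⇒≢suc i a p (ℕ.suc-injective q)

≰ᵇ-step : ∀ i a → (i ≤ᵇ a) ≡ false → i ≡ suc a ⊎ ((i ≤ᵇ suc a) ≡ false × suc a ≢ i)
≰ᵇ-step (suc zero)    zero    _ = inj₁ refl
≰ᵇ-step (suc (suc i)) zero    _ = inj₂ (refl , λ q → ℕ.0≢1+n (ℕ.suc-injective q))
≰ᵇ-step (suc i)       (suc a) p with ≰ᵇ-step i a p
... | inj₁ q       = inj₁ (cong suc q)
... | inj₂ (r , q) = inj₂ (r , q ∘ ℕ.suc-injective)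

+-≡ᵇ : ∀ i x a → (i + x ≡ᵇ a) ≡ (i ≤ᵇ a) ∧ (x ≡ᵇ a ∸ i)
+-≡ᵇ zero    x a       = refl
+-≡ᵇ (suc i) x zero    = refl
+-≡ᵇ (suc i) x (suc a) = +-≡ᵇ i x a

indicator : Bool → ℕ
indicator true  = 1
indicator false = 0

indicator-∧ : ∀ p q → indicator (p ∧ q) ≡ indicator p * indicator q
indicator-∧ false q = refl
indicator-∧ true  q = sym (ℕ.+-identityʳ (indicator q))

pred-weight : ∀ x p → x * indicator (pred x ≡ᵇ p) ≡ suc p * indicator (x ≡ᵇ suc p)
pred-weight zero    p = sym (ℕ.*-zeroʳ (suc p))
pred-weight (suc x) p with x ≡ᵇ p | ℕ.≡ᵇ⇒≡ x p
... | true  | x≡p = cong (λ n → suc n * 1) (x≡p _)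
... | false | _   = trans (ℕ.*-zeroʳ (suc x)) (sym (ℕ.*-zeroʳ (suc p)))

*-weight : ∀ m n u v w → m * u ≡ n * v → m * (u * w) ≡ n * (v * w)
*-weight m n u v w eq = trans (sym (ℕ.*-assoc m u w)) (trans (cong (_* w) eq) (ℕ.*-assoc n v w))

ℕtoℚ≡mkℚ : ∀ k → ℕtoℚ k ≡ mkℚ (ℤ.+ k) 0 (Coprime.sym (1-coprimeTo k))
ℕtoℚ≡mkℚ k = ℚ.normalize-coprime (Coprime.sym (1-coprimeTo k))

ℕtoℚ-+ : ∀ m n → ℕtoℚ (m + n) ≡ ℕtoℚ m ℚ.+ ℕtoℚ n
ℕtoℚ-+ m n rewrite ℕtoℚ≡mkℚ m | ℕtoℚ≡mkℚ n =
  cong (ℚ._/ 1) (cong₂ ℤ._+_ (sym (ℤ.*-identityʳ (ℤ.+ m))) (sym (ℤ.*-identityʳ (ℤ.+ n))))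

ℕtoℚ-* : ∀ m n → ℕtoℚ (m * n) ≡ ℕtoℚ m ℚ.* ℕtoℚ n
ℕtoℚ-* m n rewrite ℕtoℚ≡mkℚ m | ℕtoℚ≡mkℚ n = cong (ℚ._/ 1) (ℤ.pos-* m n)

Series : Set → Set
Series A = ℕ → ℕ → ℕ → A

infix 4 _≗₃_
_≗₃_ : Series A → Series A → Set
f ≗₃ g = ∀ a b c → f a b c ≡ g a b c

≗₃-sym : {f g : Series A} → f ≗₃ g → g ≗₃ f
≗₃-sym p a b c = sym (p a b c)

≗₃-trans : {f g h : Series A} → f ≗₃ g → g ≗₃ h → f ≗₃ h
≗₃-trans p q a b c = trans (p a b c) (q a b c)

-- Coefficients of x^i y^j z^k g, the missing low coefficients being 0#.
shift : A → ℕ → ℕ → ℕ → Series A → Series A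
shift 0# i j k g a b c =
  if i ≤ᵇ a then (if j ≤ᵇ b then (if k ≤ᵇ c then g (a ∸ i) (b ∸ j) (c ∸ k) else 0#) else 0#) else 0#

shift-cong : (0# : A) → ∀ i j k {g g′} → g ≗₃ g′ → shift 0# i j k g ≗₃ shift 0# i j k g′
shift-cong 0# i j k g≗g′ a b c =
  cong (λ v → if i ≤ᵇ a then (if j ≤ᵇ b then (if k ≤ᵇ c then v else 0#) else 0#) else 0#) (g≗g′ _ _ _)

shift-map : (0A : A) (0B : B) (f : A → B) → f 0A ≡ 0B → ∀ i j k g →
            shift 0B i j k (λ a b c → f (g a b c)) ≗₃ (λ a b c → f (shift 0A i j k g a b c))
shift-map 0A 0B f f0 i j k g a b c with i ≤ᵇ a | j ≤ᵇ b | k ≤ᵇ c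
... | false | _     | _     = sym f0
... | true  | false | _     = sym f0
... | true  | true  | false = sym f0
... | true  | true  | true  = refl

shift-zero : (0# : A) → ∀ i j k → shift 0# i j k (λ _ _ _ → 0#) ≗₃ (λ _ _ _ → 0#)
shift-zero 0# i j k a b c with i ≤ᵇ a | j ≤ᵇ b | k ≤ᵇ c
... | false | _     | _     = refl
... | true  | false | _     = refl
... | true  | true  | false = refl
... | true  | true  | true  = refl

shift-map₂ : (0# : A) (_∙_ : A → A → A) → 0# ∙ 0# ≡ 0# → ∀ i j k g h →
             shift 0# i j k (λ a b c → g a b c ∙ h a b c) ≗₃ (λ a b c → shift 0# i j k g a b c ∙ shift 0# i j k h a b c)
shift-map₂ 0# _∙_ 0∙0 i j k g h a b c with i ≤ᵇ a | j ≤ᵇ b | k ≤ᵇ c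
... | false | _     | _     = sym 0∙0
... | true  | false | _     = sym 0∙0
... | true  | true  | false = sym 0∙0
... | true  | true  | true  = refl

sumTo-zero : ∀ a (h : ℕ → ℚ) → (∀ t → h t ≡ 0ℚ) → sumTo a h ≡ 0ℚ
sumTo-zero zero    h h≡0 = h≡0 0
sumTo-zero (suc a) h h≡0 rewrite sumTo-zero a h h≡0 | h≡0 (suc a) = refl

sumTo-single : ∀ a i (h : ℕ → ℚ) → (∀ t → t ≢ i → h t ≡ 0ℚ) →
               sumTo a h ≡ (if i ≤ᵇ a then h i else 0ℚ)
sumTo-single zero    zero    h _   = refl
sumTo-single zero    (suc i) h h≡0 = h≡0 0 (λ ())
sumTo-single (suc a) i       h h≡0 rewrite sumTo-single a i h h≡0 with i ≤ᵇ a in i≤a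
... | true rewrite ≤ᵇ-step i a i≤a | h≡0 (suc a) (≤ᵇ⇒≢suc i a i≤a) = ℚ.+-identityʳ (h i)
... | false with ≰ᵇ-step i a i≤a
...   | inj₁ refl rewrite ≤ᵇ-refl a = ℚ.+-identityˡ (h (suc a))
...   | inj₂ (i≰1+a , 1+a≢i) rewrite i≰1+a | h≡0 (suc a) 1+a≢i = refl

mono-on : ∀ i j k → mono i j k i j k ≡ 1ℚ
mono-on i j k rewrite ≡ᵇ-refl i | ≡ᵇ-refl j | ≡ᵇ-refl k = refl

mono-off₁ : ∀ i j k t u v → t ≢ i → mono i j k t u v ≡ 0ℚ
mono-off₁ i j k t u v t≢i rewrite ≢⇒≡ᵇ-false t i t≢i = refl

mono-off₂ : ∀ i j k u v → u ≢ j → mono i j k i u v ≡ 0ℚ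
mono-off₂ i j k u v u≢j rewrite ≡ᵇ-refl i | ≢⇒≡ᵇ-false u j u≢j = refl

mono-off₃ : ∀ i j k v → v ≢ k → mono i j k i j v ≡ 0ℚ
mono-off₃ i j k v v≢k rewrite ≡ᵇ-refl i | ≡ᵇ-refl j | ≢⇒≡ᵇ-false v k v≢k = refl

mono-⊗ : ∀ i j k {f} g → f ≗₃ mono i j k → f ⊗ g ≗₃ shift 0ℚ i j k g
mono-⊗ i j k {f} g f≗m a b c = begin
  (f ⊗ g) a b c
    ≡⟨ sumTo-single a i _ (λ t t≢i → sumTo-zero b _ λ u → sumTo-zero c _ λ v →
         vanish (trans (f≗m t u v) (mono-off₁ i j k t u v t≢i))) ⟩
  when (i ≤ᵇ a) (sumTo b λ u → sumTo c λ v → f i u v ℚ.* g (a ∸ i) (b ∸ u) (c ∸ v))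
    ≡⟨ cong (when (i ≤ᵇ a)) (sumTo-single b j _ λ u u≢j → sumTo-zero c _ λ v →
         vanish (trans (f≗m i u v) (mono-off₂ i j k u v u≢j))) ⟩
  when (i ≤ᵇ a) (when (j ≤ᵇ b) (sumTo c λ v → f i j v ℚ.* g (a ∸ i) (b ∸ j) (c ∸ v)))
    ≡⟨ cong (when (i ≤ᵇ a) ∘ when (j ≤ᵇ b)) (sumTo-single c k _ λ v v≢k →
         vanish (trans (f≗m i j v) (mono-off₃ i j k v v≢k))) ⟩
  when (i ≤ᵇ a) (when (j ≤ᵇ b) (when (k ≤ᵇ c) (f i j k ℚ.* g (a ∸ i) (b ∸ j) (c ∸ k))))
    ≡⟨ cong (when (i ≤ᵇ a) ∘ when (j ≤ᵇ b) ∘ when (k ≤ᵇ c))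
         (trans (cong (ℚ._* _) (trans (f≗m i j k) (mono-on i j k))) (ℚ.*-identityˡ _)) ⟩
  shift 0ℚ i j k g a b c ∎
  where
  open ≡-Reasoning
  when : Bool → ℚ → ℚ
  when p r = if p then r else 0ℚ
  vanish : ∀ {p} {q} → p ≡ 0ℚ → p ℚ.* q ≡ 0ℚ
  vanish {q = q} refl = ℚ.*-zeroˡ q

X⊗Y≗xy : X ⊗ Y ≗₃ mono 1 1 0
X⊗Y≗xy a b c = trans (mono-⊗ 1 0 0 Y (λ _ _ _ → refl) a b c) (shifted a b c)
  where
  shifted : shift 0ℚ 1 0 0 Y ≗₃ mono 1 1 0
  shifted zero    b c = refl
  shifted (suc a) b c = refl

X⊗Y⊗Z≗xyz : X ⊗ Y ⊗ Z ≗₃ mono 1 1 1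
X⊗Y⊗Z≗xyz a b c = trans (mono-⊗ 1 1 0 Z X⊗Y≗xy a b c) (shifted a b c)
  where
  shifted : shift 0ℚ 1 1 0 Z ≗₃ mono 1 1 1
  shifted zero          b       c = refl
  shifted (suc zero)    zero    c = refl
  shifted (suc (suc a)) zero    c = refl
  shifted (suc a)       (suc b) c = refl

Δ : Poly → Poly
Δ f a b c = ∂x f a b c ℚ.+ ∂y f a b c ℚ.+ ∂z f a b c

Δ-cong : ∀ {f g} → f ≗₃ g → Δ f ≗₃ Δ g
Δ-cong f≗g a b c = cong₂ ℚ._+_
  (cong₂ ℚ._+_ (cong (ℕtoℚ (suc a) ℚ.*_) (f≗g _ _ _)) (cong (ℕtoℚ (suc b) ℚ.*_) (f≗g _ _ _)))
  (cong (ℕtoℚ (suc c) ℚ.*_) (f≗g _ _ _))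

Δℕ : Series ℕ → Series ℕ
Δℕ F a b c = suc a * F (suc a) b c + suc b * F a (suc b) c + suc c * F a b (suc c)

toPoly : Series ℕ → Poly
toPoly F a b c = ℕtoℚ (F a b c)

Δ-toPoly : ∀ F → Δ (toPoly F) ≗₃ toPoly (Δℕ F)
Δ-toPoly F a b c = sym (begin
  ℕtoℚ (sa * F (suc a) b c + sb * F a (suc b) c + sc * F a b (suc c))
    ≡⟨ ℕtoℚ-+ (sa * F (suc a) b c + sb * F a (suc b) c) (sc * F a b (suc c)) ⟩
  ℕtoℚ (sa * F (suc a) b c + sb * F a (suc b) c) ℚ.+ ℕtoℚ (sc * F a b (suc c))
    ≡⟨ cong₂ ℚ._+_ (ℕtoℚ-+ (sa * F (suc a) b c) (sb * F a (suc b) c)) (ℕtoℚ-* sc (F a b (suc c))) ⟩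
  ℕtoℚ (sa * F (suc a) b c) ℚ.+ ℕtoℚ (sb * F a (suc b) c) ℚ.+ ℕtoℚ sc ℚ.* ℕtoℚ (F a b (suc c))
    ≡⟨ cong (ℚ._+ (ℕtoℚ sc ℚ.* ℕtoℚ (F a b (suc c)))) (cong₂ ℚ._+_ (ℕtoℚ-* sa (F (suc a) b c)) (ℕtoℚ-* sb (F a (suc b) c))) ⟩
  Δ (toPoly F) a b c ∎)
  where
  open ≡-Reasoning
  sa = suc a
  sb = suc b
  sc = suc c

module DiagonalDerivation {h : Poly} (i j k : ℕ) (h≗xⁱyʲzᵏ : h ≗₃ mono i j k) where

  derivation≗shiftΔ : ∀ f → derivation h h h f ≗₃ shift 0ℚ i j k (Δ f)
  derivation≗shiftΔ f a b c = begin
    derivation h h h f a b c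
      ≡⟨ cong₂ ℚ._+_ (cong₂ ℚ._+_ (mono-⊗ i j k (∂x f) h≗xⁱyʲzᵏ a b c) (mono-⊗ i j k (∂y f) h≗xⁱyʲzᵏ a b c))
                     (mono-⊗ i j k (∂z f) h≗xⁱyʲzᵏ a b c) ⟩
    shift 0ℚ i j k (∂x f) a b c ℚ.+ shift 0ℚ i j k (∂y f) a b c ℚ.+ shift 0ℚ i j k (∂z f) a b c
      ≡⟨ cong (ℚ._+ shift 0ℚ i j k (∂z f) a b c) (sym (shift-map₂ 0ℚ ℚ._+_ 0+0 i j k (∂x f) (∂y f) a b c)) ⟩
    shift 0ℚ i j k (λ p q r → ∂x f p q r ℚ.+ ∂y f p q r) a b c ℚ.+ shift 0ℚ i j k (∂z f) a b c
      ≡⟨ sym (shift-map₂ 0ℚ ℚ._+_ 0+0 i j k (λ p q r → ∂x f p q r ℚ.+ ∂y f p q r) (∂z f) a b c) ⟩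
    shift 0ℚ i j k (Δ f) a b c ∎
    where
    open ≡-Reasoning
    0+0 : 0ℚ ℚ.+ 0ℚ ≡ 0ℚ
    0+0 = ℚ.+-identityʳ 0ℚ

  derivation-cong : ∀ {f g} → f ≗₃ g → derivation h h h f ≗₃ derivation h h h g
  derivation-cong {f} {g} f≗g a b c = trans (derivation≗shiftΔ f a b c)
    (trans (shift-cong 0ℚ i j k (Δ-cong f≗g) a b c) (sym (derivation≗shiftΔ g a b c)))

  derivation-toPoly : ∀ F → derivation h h h (toPoly F) ≗₃ toPoly (shift 0 i j k (Δℕ F))
  derivation-toPoly F a b c = trans (derivation≗shiftΔ (toPoly F) a b c)
    (trans (shift-cong 0ℚ i j k (Δ-toPoly F) a b c) (shift-map 0 0ℚ ℕtoℚ refl i j k (Δℕ F) a b c))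

module D₁ = DiagonalDerivation 1 1 0 X⊗Y≗xy
module D₂ = DiagonalDerivation 1 1 1 X⊗Y⊗Z≗xyz

Exponent : Set
Exponent = ℕ × ℕ × ℕ

infixl 6 _+ₑ_
_+ₑ_ : Exponent → Exponent → Exponent
(i , j , k) +ₑ (x , y , z) = (i + x , j + y , k + z)

isAt : Exponent → ℕ → ℕ → ℕ → Bool
isAt (x , y , z) a b c = (x ≡ᵇ a) ∧ (y ≡ᵇ b) ∧ (z ≡ᵇ c)

series : List Exponent → Series ℕ
series []       a b c = 0
series (e ∷ es) a b c = indicator (isAt e a b c) + series es a b c

series-++ : ∀ es fs a b c → series (es ++ fs) a b c ≡ series es a b c + series fs a b c
series-++ []       fs a b c = refl
series-++ (e ∷ es) fs a b c =
  trans (cong (indicator (isAt e a b c) +_) (series-++ es fs a b c)) (sym (ℕ.+-assoc (indicator (isAt e a b c)) (series es a b c) (series fs a b c)))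

series-↭ : ∀ {es fs} → es ↭ fs → series es ≗₃ series fs
series-↭ ↭.refl                  a b c = refl
series-↭ (prep e p)              a b c = cong (indicator (isAt e a b c) +_) (series-↭ p a b c)
series-↭ (swap e f p)            a b c = trans (cong (λ n → u + (v + n)) (series-↭ p a b c))
                                               (+-exchange u v _)
  where
  u = indicator (isAt e a b c)
  v = indicator (isAt f a b c)
series-↭ (↭.trans p q)           a b c = trans (series-↭ p a b c) (series-↭ q a b c)

mono≗series : ∀ i j k → mono i j k ≗₃ toPoly (series [ (i , j , k) ])
mono≗series i j k a b c rewrite ≡ᵇ-sym a i | ≡ᵇ-sym b j | ≡ᵇ-sym c k with (i ≡ᵇ a) ∧ (j ≡ᵇ b) ∧ (k ≡ᵇ c)
... | true  = refl
... | false = refl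

isAt-+ₑ : ∀ i j k e a b c → indicator (isAt ((i , j , k) +ₑ e) a b c) ≡
          shift 0 i j k (λ a b c → indicator (isAt e a b c)) a b c
isAt-+ₑ i j k (x , y , z) a b c
  rewrite +-≡ᵇ i x a | +-≡ᵇ j y b | +-≡ᵇ k z c
  with i ≤ᵇ a | j ≤ᵇ b | k ≤ᵇ c
... | false | _     | _     = refl
... | true  | false | _     rewrite ∧-zeroʳ (x ≡ᵇ a ∸ i) = refl
... | true  | true  | false rewrite ∧-zeroʳ (y ≡ᵇ b ∸ j) | ∧-zeroʳ (x ≡ᵇ a ∸ i) = refl
... | true  | true  | true  = refl

series-shift : ∀ i j k es → series (map ((i , j , k) +ₑ_) es) ≗₃ shift 0 i j k (series es)
series-shift i j k []       a b c = sym (shift-zero 0 i j k a b c)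
series-shift i j k (e ∷ es) a b c =
  trans (cong₂ _+_ (isAt-+ₑ i j k e a b c) (series-shift i j k es a b c))
        (sym (shift-map₂ 0 _+_ refl i j k (λ a b c → indicator (isAt e a b c)) (series es) a b c))

-- The monomials of (∂x + ∂y + ∂z) xˣ yʸ zᶻ, listed with multiplicity.
derivatives : Exponent → List Exponent
derivatives (x , y , z) =
  replicate x (pred x , y , z) ++ replicate y (x , pred y , z) ++ replicate z (x , y , pred z)

series-replicate : ∀ m e a b c → series (replicate m e) a b c ≡ m * indicator (isAt e a b c)
series-replicate zero    e a b c = refl
series-replicate (suc m) e a b c = cong (indicator (isAt e a b c) +_) (series-replicate m e a b c)

series-derivatives₁ : ∀ e p q r →
  series (derivatives e) p q r ≡ Δℕ (λ a b c → indicator (isAt e a b c)) p q r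
series-derivatives₁ (x , y , z) p q r
  rewrite series-++ (replicate x (pred x , y , z)) (replicate y (x , pred y , z) ++ replicate z (x , y , pred z)) p q r
        | series-++ (replicate y (x , pred y , z)) (replicate z (x , y , pred z)) p q r
        | series-replicate x (pred x , y , z) p q r
        | series-replicate y (x , pred y , z) p q r
        | series-replicate z (x , y , pred z) p q r
        | indicator-∧ (pred x ≡ᵇ p) ((y ≡ᵇ q) ∧ (z ≡ᵇ r)) | indicator-∧ (x ≡ᵇ suc p) ((y ≡ᵇ q) ∧ (z ≡ᵇ r))
        | indicator-∧ (x ≡ᵇ p) ((pred y ≡ᵇ q) ∧ (z ≡ᵇ r)) | indicator-∧ (x ≡ᵇ p) ((y ≡ᵇ suc q) ∧ (z ≡ᵇ r))
        | indicator-∧ (pred y ≡ᵇ q) (z ≡ᵇ r) | indicator-∧ (y ≡ᵇ suc q) (z ≡ᵇ r)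
        | indicator-∧ (x ≡ᵇ p) ((y ≡ᵇ q) ∧ (pred z ≡ᵇ r)) | indicator-∧ (x ≡ᵇ p) ((y ≡ᵇ q) ∧ (z ≡ᵇ suc r))
        | indicator-∧ (y ≡ᵇ q) (pred z ≡ᵇ r) | indicator-∧ (y ≡ᵇ q) (z ≡ᵇ suc r)
  = trans (sym (ℕ.+-assoc (x * (δx₋ * δyz)) _ _)) (cong₂ _+_ (cong₂ _+_ along-x along-y) along-z)
  where
  δx₋ = indicator (pred x ≡ᵇ p)
  δx  = indicator (x ≡ᵇ p)
  δy₋ = indicator (pred y ≡ᵇ q)
  δy  = indicator (y ≡ᵇ q)
  δz₋ = indicator (pred z ≡ᵇ r)
  δz  = indicator (z ≡ᵇ r)
  δyz = indicator ((y ≡ᵇ q) ∧ (z ≡ᵇ r))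

  along-x : x * (δx₋ * δyz) ≡ suc p * (indicator (x ≡ᵇ suc p) * δyz)
  along-x = *-weight x (suc p) δx₋ _ δyz (pred-weight x p)

  along-y : y * (δx * (δy₋ * δz)) ≡ suc q * (δx * (indicator (y ≡ᵇ suc q) * δz))
  along-y = trans (*-exchange y δx _)
           (trans (cong (δx *_) (*-weight y (suc q) δy₋ _ δz (pred-weight y q)))
                  (*-exchange δx (suc q) _))

  along-z : z * (δx * (δy * δz₋)) ≡ suc r * (δx * (δy * indicator (z ≡ᵇ suc r)))
  along-z = trans (*-exchange z δx _)
           (trans (cong (δx *_) (trans (*-exchange z δy _) (trans (cong (δy *_) (pred-weight z r)) (*-exchange δy (suc r) _))))
                  (*-exchange δx (suc r) _))

Δℕ-+ : ∀ F G p q r → Δℕ (λ a b c → F a b c + G a b c) p q r ≡ Δℕ F p q r + Δℕ G p q r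
Δℕ-+ F G p q r = distrib (suc p) (suc q) (suc r)
  (F (suc p) q r) (F p (suc q) r) (F p q (suc r)) (G (suc p) q r) (G p (suc q) r) (G p q (suc r))
  where
  distrib : ∀ sp sq sr f₁ f₂ f₃ g₁ g₂ g₃ →
    sp * (f₁ + g₁) + sq * (f₂ + g₂) + sr * (f₃ + g₃) ≡ (sp * f₁ + sq * f₂ + sr * f₃) + (sp * g₁ + sq * g₂ + sr * g₃)
  distrib = solve-∀

series-derivatives : ∀ es → series (concatMap derivatives es) ≗₃ Δℕ (series es)
series-derivatives []       p q r = sym (annihilate (suc p) (suc q) (suc r))
  where
  annihilate : ∀ sp sq sr → sp * 0 + sq * 0 + sr * 0 ≡ 0
  annihilate = solve-∀
series-derivatives (e ∷ es) p q r = begin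
  series (derivatives e ++ concatMap derivatives es) p q r
    ≡⟨ series-++ (derivatives e) (concatMap derivatives es) p q r ⟩
  series (derivatives e) p q r + series (concatMap derivatives es) p q r
    ≡⟨ cong₂ _+_ (series-derivatives₁ e p q r) (series-derivatives es p q r) ⟩
  Δℕ (λ a b c → indicator (isAt e a b c)) p q r + Δℕ (series es) p q r
    ≡⟨ sym (Δℕ-+ (λ a b c → indicator (isAt e a b c)) (series es) p q r) ⟩
  Δℕ (series (e ∷ es)) p q r ∎
  where open ≡-Reasoning

derive : Exponent → List Exponent → List Exponent
derive h es = map (h +ₑ_) (concatMap derivatives es)

series-derive : ∀ i j k es → series (derive (i , j , k) es) ≗₃ shift 0 i j k (Δℕ (series es))
series-derive i j k es a b c =
  trans (series-shift i j k (concatMap derivatives es) a b c) (shift-cong 0 i j k (series-derivatives es) a b c)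

D₁-series : ∀ es → D₁ (toPoly (series es)) ≗₃ toPoly (series (derive (1 , 1 , 0) es))
D₁-series es a b c = trans (D₁.derivation-toPoly (series es) a b c) (cong ℕtoℚ (sym (series-derive 1 1 0 es a b c)))

D₂-series : ∀ es → D₂ (toPoly (series es)) ≗₃ toPoly (series (derive (1 , 1 , 1) es))
D₂-series es a b c = trans (D₂.derivation-toPoly (series es) a b c) (cong ℕtoℚ (sym (series-derive 1 1 1 es a b c)))

data IsUnit : Exponent → Set where
  unitˣ : IsUnit (1 , 0 , 0)
  unitʸ : IsUnit (0 , 1 , 0)
  unitᶻ : IsUnit (0 , 0 , 1)

replicate-suc-pred : ∀ n (f : ℕ → A) → replicate n (f (suc (pred n))) ≡ replicate n (f n)
replicate-suc-pred zero    f = refl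
replicate-suc-pred (suc n) f = refl

map-derivatives : ∀ e x y z → map (e +ₑ_) (derivatives (x , y , z)) ≡
  replicate x (e +ₑ (pred x , y , z)) ++ replicate y (e +ₑ (x , pred y , z)) ++ replicate z (e +ₑ (x , y , pred z))
map-derivatives e x y z = begin
  map (e +ₑ_) (replicate x _ ++ replicate y _ ++ replicate z _)
    ≡⟨ List.map-++ (e +ₑ_) (replicate x _) _ ⟩
  map (e +ₑ_) (replicate x _) ++ map (e +ₑ_) (replicate y _ ++ replicate z _)
    ≡⟨ cong (map (e +ₑ_) (replicate x _) ++_) (List.map-++ (e +ₑ_) (replicate y _) _) ⟩
  map (e +ₑ_) (replicate x _) ++ map (e +ₑ_) (replicate y _) ++ map (e +ₑ_) (replicate z _)
    ≡⟨ cong₂ _++_ (List.map-replicate (e +ₑ_) x _)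
         (cong₂ _++_ (List.map-replicate (e +ₑ_) y _) (List.map-replicate (e +ₑ_) z _)) ⟩
  _ ∎
  where open ≡-Reasoning

-- The Leibniz rule ∂(u · m) = m + u · ∂m for a variable u.
derivatives-+unit : ∀ {e} → IsUnit e → ∀ t → t ∷ map (e +ₑ_) (derivatives t) ↭ derivatives (e +ₑ t)
derivatives-+unit unitˣ (x , y , z) rewrite map-derivatives (1 , 0 , 0) x y z
                                          | replicate-suc-pred x (λ n → (n , y , z)) = ↭.refl
derivatives-+unit unitʸ (x , y , z) rewrite map-derivatives (0 , 1 , 0) x y z
                                          | replicate-suc-pred y (λ n → (x , n , z)) =
  ↭-sym (↭-shift (x , y , z) (replicate x (pred x , suc y , z)) _)
derivatives-+unit unitᶻ (x , y , z) rewrite map-derivatives (0 , 0 , 1) x y z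
                                          | replicate-suc-pred z (λ n → (x , y , n)) = begin
  (x , y , z) ∷ xs ++ ys ++ zs         ≡⟨ cong ((x , y , z) ∷_) (sym (List.++-assoc xs ys zs)) ⟩
  (x , y , z) ∷ (xs ++ ys) ++ zs       ↭⟨ ↭-shift (x , y , z) (xs ++ ys) zs ⟨
  (xs ++ ys) ++ [ (x , y , z) ] ++ zs  ≡⟨ List.++-assoc xs ys _ ⟩
  xs ++ ys ++ (x , y , z) ∷ zs         ∎
  where
  open PermutationReasoning
  xs = replicate x (pred x , y , suc z)
  ys = replicate y (x , pred y , suc z)
  zs = replicate z (x , y , z)

+ₑ-exchange : ∀ e h d → e +ₑ (h +ₑ d) ≡ h +ₑ (e +ₑ d)
+ₑ-exchange (i , j , k) (i′ , j′ , k′) (x , y , z) =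
  cong₂ _,_ (+-exchange i i′ x) (cong₂ _,_ (+-exchange j j′ y) (+-exchange k k′ z))

map-+ₑ-comm : ∀ e h ds → map (e +ₑ_) (map (h +ₑ_) ds) ≡ map (h +ₑ_) (map (e +ₑ_) ds)
map-+ₑ-comm e h ds =
  trans (sym (List.map-∘ ds)) (trans (List.map-cong (+ₑ-exchange e h) ds) (List.map-∘ ds))

step : ℕ → ℕ → Exponent
step p u = ((if p <ᵇ u then 1 else 0) , (if u <ᵇ p then 1 else 0) , (if p ≡ᵇ u then 1 else 0))

step-unit : ∀ p u → IsUnit (step p u)
step-unit p u with ℕ.<-cmp p u
... | tri< p<u p≢u p≯u rewrite <ᵇ-true p<u | <ᵇ-false p≯u | ≢⇒≡ᵇ-false p u p≢u = unitˣ
... | tri≈ p≮u refl _  rewrite <ᵇ-false p≮u | ≡ᵇ-refl p = unitᶻ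
... | tri> p≮u p≢u p>u rewrite <ᵇ-false p≮u | <ᵇ-true p>u | ≢⇒≡ᵇ-false p u p≢u = unitʸ

statsFrom : ℕ → List ℕ → Exponent
statsFrom p w = (ascL (p ∷ w ++ [ 0 ]) , desL (p ∷ w ++ [ 0 ]) , platL (p ∷ w ++ [ 0 ]))

stats : List ℕ → Exponent
stats = statsFrom 0

insertions : List ℕ → List ℕ → List (List ℕ)
insertions s []      = [ s ]
insertions s (u ∷ r) = (s ++ u ∷ r) ∷ map (u ∷_) (insertions s r)

record InsertableBlock (s : List ℕ) (h : Exponent) (M : ℕ) : Set where
  field
    before-letter : ∀ {p u} r → p < M → u < M → statsFrom p (s ++ u ∷ r) ≡ h +ₑ statsFrom u r
    at-end        : ∀ {p} → p < M → statsFrom p s ≡ h +ₑ (0 , 0 , 0)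

statsFrom-insertions : ∀ {s h M} → InsertableBlock s h M → ∀ {p} w → p < M → All (_< M) w →
  map (statsFrom p) (insertions s w) ↭ map (h +ₑ_) (derivatives (statsFrom p w))
statsFrom-insertions {h = h} blk {p} [] p<M [] rewrite InsertableBlock.at-end blk p<M =
  map⁺ (h +ₑ_) (derivatives-+unit (step-unit p 0) (0 , 0 , 0))
statsFrom-insertions {s} {h} blk {p} (u ∷ r) p<M (u<M ∷ r<M) = begin
  statsFrom p (s ++ u ∷ r) ∷ map (statsFrom p) (map (u ∷_) (insertions s r))
    ≡⟨ cong₂ _∷_ (InsertableBlock.before-letter blk r p<M u<M) (sym (List.map-∘ (insertions s r))) ⟩
  (h +ₑ t) ∷ map (λ w → step p u +ₑ statsFrom u w) (insertions s r)
    ≡⟨ cong ((h +ₑ t) ∷_) (List.map-∘ (insertions s r)) ⟩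
  (h +ₑ t) ∷ map (step p u +ₑ_) (map (statsFrom u) (insertions s r))
    ↭⟨ prep (h +ₑ t) (map⁺ (step p u +ₑ_) (statsFrom-insertions blk r u<M r<M)) ⟩
  (h +ₑ t) ∷ map (step p u +ₑ_) (map (h +ₑ_) (derivatives t))
    ≡⟨ cong ((h +ₑ t) ∷_) (map-+ₑ-comm (step p u) h (derivatives t)) ⟩
  map (h +ₑ_) (t ∷ map (step p u +ₑ_) (derivatives t))
    ↭⟨ map⁺ (h +ₑ_) (derivatives-+unit (step-unit p u) t) ⟩
  map (h +ₑ_) (derivatives (step p u +ₑ t)) ∎
  where
  open PermutationReasoning
  t = statsFrom u r

concatMap-cong-↭ : ∀ {P : A → Set} (f g : A → List B) {xs} → All P xs → (∀ {x} → P x → f x ↭ g x) →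
              concatMap f xs ↭ concatMap g xs
concatMap-cong-↭ f g []         f↭g = ↭.refl
concatMap-cong-↭ f g (px ∷ pxs) f↭g = ++⁺ (f↭g px) (concatMap-cong-↭ f g pxs f↭g)

concatMap-resp-↭ : ∀ (f : A → List B) {xs ys} → xs ↭ ys → concatMap f xs ↭ concatMap f ys
concatMap-resp-↭ f ↭.refl        = ↭.refl
concatMap-resp-↭ f (prep x p)    = ++⁺ˡ (f x) (concatMap-resp-↭ f p)
concatMap-resp-↭ f (swap x y p)  = ↭.trans (shifts (f x) (f y)) (++⁺ˡ (f y) (++⁺ˡ (f x) (concatMap-resp-↭ f p)))
concatMap-resp-↭ f (↭.trans p q) = ↭.trans (concatMap-resp-↭ f p) (concatMap-resp-↭ f q)

∈-concatMap⁻′ : ∀ (f : A → List B) xs {y} → y ∈ concatMap f xs → ∃ λ x → x ∈ xs × y ∈ f x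
∈-concatMap⁻′ f xs y∈ = find (∈-concatMap⁻ f y∈)

∈-concatMap⁺′ : ∀ (f : A → List B) {xs x y} → x ∈ xs → y ∈ f x → y ∈ concatMap f xs
∈-concatMap⁺′ f x∈ y∈ = ∈-concatMap⁺ f (lose x∈ y∈)

unique-concatMap : ∀ (f : A → List B) (r : B → A) {xs} → Unique xs → (∀ {x} → x ∈ xs → Unique (f x)) →
                   (∀ {x y} → x ∈ xs → y ∈ f x → r y ≡ x) → Unique (concatMap f xs)
unique-concatMap f r []                   _  _   = []
unique-concatMap f r {x ∷ xs} (x∉ ∷ !xs) !f r∘f =
  Unique.++⁺ (!f (here refl)) (unique-concatMap f r !xs (!f ∘ there) (r∘f ∘ there))
    λ { (y∈fx , y∈rest) → let (x′ , x′∈ , y∈fx′) = ∈-concatMap⁻′ f xs y∈rest in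
          All.lookup x∉ x′∈ (trans (sym (r∘f (here refl) y∈fx)) (r∘f (there x′∈) y∈fx′)) }

head-or-0 : List ℕ → ℕ
head-or-0 []      = 0
head-or-0 (a ∷ _) = a

∈-filterᵇ⁻ : ∀ (p : A → Bool) xs {x} → x ∈ filterᵇ p xs → x ∈ xs × p x ≡ true
∈-filterᵇ⁻ p (y ∷ xs) x∈ with p y in py
∈-filterᵇ⁻ p (y ∷ xs) (here refl) | true  = here refl , py
∈-filterᵇ⁻ p (y ∷ xs) (there x∈)  | true  = map₁ there (∈-filterᵇ⁻ p xs x∈)
∈-filterᵇ⁻ p (y ∷ xs) x∈          | false = map₁ there (∈-filterᵇ⁻ p xs x∈)

∈-filterᵇ⁺ : ∀ (p : A → Bool) xs {x} → x ∈ xs → p x ≡ true → x ∈ filterᵇ p xs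
∈-filterᵇ⁺ p (y ∷ xs) (here refl) px rewrite px = here refl
∈-filterᵇ⁺ p (y ∷ xs) (there x∈)  px with p y
... | true  = there (∈-filterᵇ⁺ p xs x∈ px)
... | false = ∈-filterᵇ⁺ p xs x∈ px

unique-filterᵇ : ∀ (p : A → Bool) {xs} → Unique xs → Unique (filterᵇ p xs)
unique-filterᵇ p []                   = []
unique-filterᵇ p {y ∷ xs} (y∉xs ∷ !xs) with p y
... | true  = All.tabulate (λ x∈ → All.lookup y∉xs (proj₁ (∈-filterᵇ⁻ p xs x∈))) ∷ unique-filterᵇ p !xs
... | false = unique-filterᵇ p !xs

length-filterᵇ-isAt : ∀ (f : A → Exponent) xs a b c →
  length (filterᵇ (λ x → isAt (f x) a b c) xs) ≡ series (map f xs) a b c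
length-filterᵇ-isAt f []       a b c = refl
length-filterᵇ-isAt f (x ∷ xs) a b c with isAt (f x) a b c
... | true  = cong suc (length-filterᵇ-isAt f xs a b c)
... | false = length-filterᵇ-isAt f xs a b c

all-∈⁻ : ∀ (p : A → Bool) xs → all p xs ≡ true → ∀ {x} → x ∈ xs → p x ≡ true
all-∈⁻ p (y ∷ xs) all≡ (here refl) = proj₁ ∧-conical (p y) (all p xs) all≡
all-∈⁻ p (y ∷ xs) all≡ (there x∈)  = all-∈⁻ p xs (proj₂ ∧-conical (p y) (all p xs) all≡) x∈

all-∈⁺ : ∀ (p : A → Bool) xs → (∀ {x} → x ∈ xs → p x ≡ true) → all p xs ≡ true
all-∈⁺ p []       _  = refl
all-∈⁺ p (y ∷ xs) px = cong₂ _∧_ (px (here refl)) (all-∈⁺ p xs (px ∘ there))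

∈-range⁻ : ∀ m {x} → x ∈ range m → 0 < x × x ≤ m
∈-range⁻ (suc m) x∈ with ∈-++⁻ (range m) x∈
... | inj₁ x∈′        = map₂ ℕ.m≤n⇒m≤1+n (∈-range⁻ m x∈′)
... | inj₂ (here refl) = ℕ.0<1+n , ℕ.≤-refl

∈-range⁺ : ∀ m {x} → 0 < x → x ≤ m → x ∈ range m
∈-range⁺ zero    {suc x} 0<x ()
∈-range⁺ (suc m) 0<x x≤1+m with ℕ.m≤n⇒m<n∨m≡n x≤1+m
... | inj₁ x<1+m = ∈-++⁺ˡ (∈-range⁺ m 0<x (ℕ.≤-pred x<1+m))
... | inj₂ refl  = ∈-++⁺ʳ (range m) (here refl)

unique-range : ∀ m → Unique (range m)
unique-range zero    = []
unique-range (suc m) = Unique.++⁺ (unique-range m) ([] ∷ [])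
  λ { (x∈ , here refl) → ℕ.<-irrefl refl (s≤s (proj₂ (∈-range⁻ m x∈))) }

∈-words⁻ : ∀ k xs {w} → w ∈ words k xs → length w ≡ k × (∀ {x} → x ∈ w → x ∈ xs)
∈-words⁻ zero    xs (here refl) = refl , λ ()
∈-words⁻ (suc k) xs w∈ with ∈-concatMap⁻′ (λ a → map (a ∷_) (words k xs)) xs w∈
... | a , a∈ , w∈′ with ∈-map⁻ (a ∷_) w∈′
...   | w′ , w′∈ , refl = cong suc (proj₁ (∈-words⁻ k xs w′∈))
                        , λ { (here refl) → a∈ ; (there x∈) → proj₂ (∈-words⁻ k xs w′∈) x∈ }

∈-words⁺ : ∀ k xs w → length w ≡ k → (∀ {x} → x ∈ w → x ∈ xs) → w ∈ words k xs
∈-words⁺ zero    xs []      _  _  = here refl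
∈-words⁺ (suc k) xs (u ∷ w) eq w⊆ = ∈-concatMap⁺′ (λ a → map (a ∷_) (words k xs)) (w⊆ (here refl))
  (∈-map⁺ (u ∷_) (∈-words⁺ k xs w (ℕ.suc-injective eq) (w⊆ ∘ there)))

unique-words : ∀ k xs → Unique xs → Unique (words k xs)
unique-words zero    xs _   = [] ∷ []
unique-words (suc k) xs !xs = unique-concatMap (λ a → map (a ∷_) (words k xs)) head-or-0 !xs
  (λ _ → Unique.map⁺ (λ { refl → refl }) (unique-words k xs !xs))
  (λ _ y∈ → let (_ , _ , eq) = ∈-map⁻ _ y∈ in cong head-or-0 eq)

stats-insertions : ∀ {s h M} → InsertableBlock s h M → 0 < M → ∀ L → All (All (_< M)) L →
  map stats (concatMap (insertions s) L) ↭ derive h (map stats L)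
stats-insertions {s} {h} blk 0<M L L<M = begin
  map stats (concatMap (insertions s) L)
    ≡⟨ List.map-concatMap stats (insertions s) L ⟩
  concatMap (map stats ∘ insertions s) L
    ↭⟨ concatMap-cong-↭ _ _ L<M (statsFrom-insertions blk _ 0<M) ⟩
  concatMap (map (h +ₑ_) ∘ derivatives ∘ stats) L
    ≡⟨ sym (List.map-concatMap (h +ₑ_) (derivatives ∘ stats) L) ⟩
  map (h +ₑ_) (concatMap (derivatives ∘ stats) L)
    ≡⟨ cong (map (h +ₑ_)) (sym (List.concatMap-map derivatives stats L)) ⟩
  derive h (map stats L) ∎
  where open PermutationReasoning

derive-↭ : ∀ h {es fs} → es ↭ fs → derive h es ↭ derive h fs
derive-↭ h p = map⁺ (h +ₑ_) (concatMap-resp-↭ derivatives p)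

step-up : ∀ {p M} → p < M → step p M ≡ (1 , 0 , 0)
step-up {p} {M} p<M rewrite <ᵇ-true p<M | <ᵇ-false (ℕ.<⇒≯ p<M) | ≢⇒≡ᵇ-false p M (ℕ.<⇒≢ p<M) = refl

step-down : ∀ {u M} → u < M → step M u ≡ (0 , 1 , 0)
step-down {u} {M} u<M rewrite <ᵇ-false (ℕ.<⇒≯ u<M) | <ᵇ-true u<M | ≢⇒≡ᵇ-false M u (ℕ.>⇒≢ u<M) = refl

step-flat : ∀ M → step M M ≡ (0 , 0 , 1)
step-flat M rewrite <ᵇ-false (ℕ.<-irrefl {M} refl) | ≡ᵇ-refl M = refl

single-block : ∀ M → InsertableBlock [ M ] (1 , 1 , 0) M
single-block M = record
  { before-letter = λ {p} {u} r p<M u<M →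
      cong₂ (λ e f → e +ₑ (f +ₑ statsFrom u r)) (step-up p<M) (step-down u<M)
  ; at-end = λ p<M →
      cong₂ (λ e f → e +ₑ (f +ₑ (0 , 0 , 0))) (step-up p<M) (step-down (ℕ.≤-<-trans z≤n p<M))
  }

double-block : ∀ M → InsertableBlock (M ∷ M ∷ []) (1 , 1 , 1) M
double-block M = record
  { before-letter = λ {p} {u} r p<M u<M → trans
      (cong₂ (λ e f → e +ₑ (step M M +ₑ (f +ₑ statsFrom u r))) (step-up p<M) (step-down u<M))
      (cong (λ g → (1 , 0 , 0) +ₑ (g +ₑ ((0 , 1 , 0) +ₑ statsFrom u r))) (step-flat M))
  ; at-end = λ p<M → trans
      (cong₂ (λ e f → e +ₑ (step M M +ₑ (f +ₑ (0 , 0 , 0)))) (step-up p<M) (step-down (ℕ.≤-<-trans z≤n p<M)))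
      (cong (λ g → (1 , 0 , 0) +ₑ (g +ₑ ((0 , 1 , 0) +ₑ (0 , 0 , 0)))) (step-flat M))
  }

count-++ : ∀ v xs ys → count v (xs ++ ys) ≡ count v xs + count v ys
count-++ v []       ys = refl
count-++ v (u ∷ xs) ys with u ≡ᵇ v
... | true  = cong suc (count-++ v xs ys)
... | false = count-++ v xs ys

count-∉ : ∀ v xs → v ∉ xs → count v xs ≡ 0
count-∉ v []       _   = refl
count-∉ v (u ∷ xs) v∉ rewrite ≢⇒≡ᵇ-false u v (λ u≡v → v∉ (here (sym u≡v))) = count-∉ v xs (v∉ ∘ there)

count≡0⇒∉ : ∀ v xs → count v xs ≡ 0 → v ∉ xs
count≡0⇒∉ v (u ∷ xs) c≡0 (here refl) rewrite ≡ᵇ-refl u = ℕ.1+n≢0 c≡0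
count≡0⇒∉ v (u ∷ xs) c≡0 (there v∈) with u ≡ᵇ v
... | true  = ℕ.1+n≢0 c≡0
... | false = count≡0⇒∉ v xs c≡0 v∈

count-self : ∀ a → count a [ a ] ≡ 1
count-self a rewrite ≡ᵇ-refl a = refl

count-self² : ∀ a → count a (a ∷ a ∷ []) ≡ 2
count-self² a rewrite ≡ᵇ-refl a = refl

∉-single : ∀ {v a : ℕ} → v ≢ a → v ∉ [ a ]
∉-single v≢a (here v≡a) = v≢a v≡a

∉-double : ∀ {v a : ℕ} → v ≢ a → v ∉ a ∷ a ∷ []
∉-double v≢a (here v≡a)         = v≢a v≡a
∉-double v≢a (there (here v≡a)) = v≢a v≡a

∈-insertions⁺ : ∀ s pre suf → pre ++ s ++ suf ∈ insertions s (pre ++ suf)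
∈-insertions⁺ s []        []        = here (List.++-identityʳ s)
∈-insertions⁺ s []        (u ∷ suf) = here refl
∈-insertions⁺ s (u ∷ pre) suf       = there (∈-map⁺ (u ∷_) (∈-insertions⁺ s pre suf))

∈-insertions⁻ : ∀ s w {g} → g ∈ insertions s w → ∃₂ λ pre suf → w ≡ pre ++ suf × g ≡ pre ++ s ++ suf
∈-insertions⁻ s []      (here refl) = [] , [] , refl , sym (List.++-identityʳ s)
∈-insertions⁻ s (u ∷ r) (here refl) = [] , u ∷ r , refl , refl
∈-insertions⁻ s (u ∷ r) (there g∈) with ∈-map⁻ (u ∷_) g∈
... | g′ , g′∈ , refl with ∈-insertions⁻ s r g′∈
...   | pre , suf , refl , refl = u ∷ pre , suf , refl , refl

dropUntil-++ : ∀ v s l → v ∉ s → dropUntil v (s ++ l) ≡ dropUntil v l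
dropUntil-++ v []      l _  = refl
dropUntil-++ v (u ∷ s) l v∉ rewrite ≢⇒≡ᵇ-false u v (λ u≡v → v∉ (here (sym u≡v))) = dropUntil-++ v s l (v∉ ∘ there)

takeUntil-++ : ∀ v s l → v ∉ s → takeUntil v (s ++ l) ≡ s ++ takeUntil v l
takeUntil-++ v []      l _  = refl
takeUntil-++ v (u ∷ s) l v∉ rewrite ≢⇒≡ᵇ-false u v (λ u≡v → v∉ (here (sym u≡v))) =
  cong (u ∷_) (takeUntil-++ v s l (v∉ ∘ there))

takeUntil-insert⁻ : ∀ v s pre suf → v ∉ s → ∀ {x} →
  x ∈ takeUntil v (pre ++ s ++ suf) → x ∈ takeUntil v (pre ++ suf) ⊎ x ∈ s
takeUntil-insert⁻ v s [] suf v∉ x∈ rewrite takeUntil-++ v s suf v∉ with ∈-++⁻ s x∈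
... | inj₁ x∈s = inj₂ x∈s
... | inj₂ x∈t = inj₁ x∈t
takeUntil-insert⁻ v s (u ∷ pre) suf v∉ x∈ with u ≡ᵇ v
takeUntil-insert⁻ v s (u ∷ pre) suf v∉ ()          | true
takeUntil-insert⁻ v s (u ∷ pre) suf v∉ (here refl) | false = inj₁ (here refl)
takeUntil-insert⁻ v s (u ∷ pre) suf v∉ (there x∈)  | false =
  Sum.map₁ there (takeUntil-insert⁻ v s pre suf v∉ x∈)

takeUntil-insert⁺ : ∀ v s pre suf → v ∉ s → ∀ {x} →
  x ∈ takeUntil v (pre ++ suf) → x ∈ takeUntil v (pre ++ s ++ suf)
takeUntil-insert⁺ v s [] suf v∉ x∈ rewrite takeUntil-++ v s suf v∉ = ∈-++⁺ʳ s x∈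
takeUntil-insert⁺ v s (u ∷ pre) suf v∉ x∈ with u ≡ᵇ v
takeUntil-insert⁺ v s (u ∷ pre) suf v∉ ()          | true
takeUntil-insert⁺ v s (u ∷ pre) suf v∉ (here refl) | false = here refl
takeUntil-insert⁺ v s (u ∷ pre) suf v∉ (there x∈)  | false = there (takeUntil-insert⁺ v s pre suf v∉ x∈)

between-insert⁻ : ∀ v s pre suf → v ∉ s → ∀ {x} →
  x ∈ between v (pre ++ s ++ suf) → x ∈ between v (pre ++ suf) ⊎ x ∈ s
between-insert⁻ v s []        suf v∉ x∈ rewrite dropUntil-++ v s suf v∉ = inj₁ x∈
between-insert⁻ v s (u ∷ pre) suf v∉ x∈ with u ≡ᵇ v
... | true  = takeUntil-insert⁻ v s pre suf v∉ x∈
... | false = between-insert⁻ v s pre suf v∉ x∈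

between-insert⁺ : ∀ v s pre suf → v ∉ s → ∀ {x} →
  x ∈ between v (pre ++ suf) → x ∈ between v (pre ++ s ++ suf)
between-insert⁺ v s []        suf v∉ x∈ rewrite dropUntil-++ v s suf v∉ = x∈
between-insert⁺ v s (u ∷ pre) suf v∉ x∈ with u ≡ᵇ v
... | true  = takeUntil-insert⁺ v s pre suf v∉ x∈
... | false = between-insert⁺ v s pre suf v∉ x∈

between-adjacent : ∀ v pre suf → v ∉ pre → between v (pre ++ v ∷ v ∷ suf) ≡ []
between-adjacent v []        suf _  rewrite ≡ᵇ-refl v | ≡ᵇ-refl v = refl
between-adjacent v (u ∷ pre) suf v∉ rewrite ≢⇒≡ᵇ-false u v (λ u≡v → v∉ (here (sym u≡v))) =
  between-adjacent v pre suf (v∉ ∘ there)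

takeUntil-⊆ : ∀ v l {x} → x ∈ takeUntil v l → x ∈ l
takeUntil-⊆ v (u ∷ l) x∈ with u ≡ᵇ v
takeUntil-⊆ v (u ∷ l) ()          | true
takeUntil-⊆ v (u ∷ l) (here refl) | false = here refl
takeUntil-⊆ v (u ∷ l) (there x∈)  | false = there (takeUntil-⊆ v l x∈)

dropUntil-⊆ : ∀ v l {x} → x ∈ dropUntil v l → x ∈ l
dropUntil-⊆ v (u ∷ l) x∈ with u ≡ᵇ v
... | true  = there x∈
... | false = there (dropUntil-⊆ v l x∈)

between-⊆ : ∀ v l {x} → x ∈ between v l → x ∈ l
between-⊆ v l = dropUntil-⊆ v l ∘ takeUntil-⊆ v (dropUntil v l)

split-once : ∀ v w → count v w ≡ 1 → ∃₂ λ pre suf → w ≡ pre ++ v ∷ suf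
split-once v (u ∷ w) c with u ≡ᵇ v | ℕ.≡ᵇ⇒≡ u v
... | true  | u≡v = [] , w , cong (_∷ w) (u≡v _)
... | false | _   with split-once v w c
...   | pre , suf , refl = u ∷ pre , suf , refl

split-twice-adjacent : ∀ v w → count v w ≡ 2 → between v w ≡ [] → ∃₂ λ pre suf → w ≡ pre ++ v ∷ v ∷ suf
split-twice-adjacent v (u ∷ w) c b with u ≡ᵇ v | ℕ.≡ᵇ⇒≡ u v
split-twice-adjacent v (u ∷ []) () b      | true | _
split-twice-adjacent v (u ∷ u′ ∷ w) c b   | true | u≡v with u′ ≡ᵇ v | ℕ.≡ᵇ⇒≡ u′ v
... | true  | u′≡v = [] , w , cong₂ (λ a a′ → a ∷ a′ ∷ w) (u≡v _) (u′≡v _)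
split-twice-adjacent v (u ∷ u′ ∷ w) c () | true | _ | false | _
split-twice-adjacent v (u ∷ w) c b       | false | _ with split-twice-adjacent v w c b
... | pre , suf , refl = u ∷ pre , suf , refl

module _ (s : List ℕ) {w g : List ℕ} (g∈ : g ∈ insertions s w) where

  insertion-length : length g ≡ length s + length w
  insertion-length with ∈-insertions⁻ s w g∈
  ... | pre , suf , refl , refl
    rewrite List.length-++ pre {s ++ suf} | List.length-++ s {suf} | List.length-++ pre {suf} =
    +-exchange (length pre) (length s) (length suf)

  insertion-count : ∀ v → count v g ≡ count v s + count v w
  insertion-count v with ∈-insertions⁻ s w g∈
  ... | pre , suf , refl , refl
    rewrite count-++ v pre (s ++ suf) | count-++ v s suf | count-++ v pre suf =
    +-exchange (count v pre) (count v s) (count v suf)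

  insertion-∈⁻ : ∀ {x} → x ∈ g → x ∈ s ⊎ x ∈ w
  insertion-∈⁻ x∈ with ∈-insertions⁻ s w g∈
  ... | pre , suf , refl , refl with ∈-++⁻ pre x∈
  ...   | inj₁ x∈pre = inj₂ (∈-++⁺ˡ x∈pre)
  ...   | inj₂ x∈rest with ∈-++⁻ s x∈rest
  ...     | inj₁ x∈s   = inj₁ x∈s
  ...     | inj₂ x∈suf = inj₂ (∈-++⁺ʳ pre x∈suf)

  insertion-∈⁺ : ∀ {x} → x ∈ w → x ∈ g
  insertion-∈⁺ x∈ with ∈-insertions⁻ s w g∈
  ... | pre , suf , refl , refl with ∈-++⁻ pre x∈
  ...   | inj₁ x∈pre = ∈-++⁺ˡ x∈pre
  ...   | inj₂ x∈suf = ∈-++⁺ʳ pre (∈-++⁺ʳ s x∈suf)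

  insertion-between⁻ : ∀ v → v ∉ s → ∀ {x} → x ∈ between v g → x ∈ between v w ⊎ x ∈ s
  insertion-between⁻ v v∉ x∈ with ∈-insertions⁻ s w g∈
  ... | pre , suf , refl , refl = between-insert⁻ v s pre suf v∉ x∈

  insertion-between⁺ : ∀ v → v ∉ s → ∀ {x} → x ∈ between v w → x ∈ between v g
  insertion-between⁺ v v∉ x∈ with ∈-insertions⁻ s w g∈
  ... | pre , suf , refl , refl = between-insert⁺ v s pre suf v∉ x∈

insertion-adjacent : ∀ v {w g} → g ∈ insertions (v ∷ v ∷ []) w → v ∉ w → between v g ≡ []
insertion-adjacent v {w} g∈ v∉ with ∈-insertions⁻ (v ∷ v ∷ []) w g∈
... | pre , suf , refl , refl = between-adjacent v pre suf (v∉ ∘ ∈-++⁺ˡ)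

remove : ℕ → List ℕ → List ℕ
remove M = filterᵇ (λ x → not (x ≡ᵇ M))

remove-++ : ∀ M xs ys → remove M (xs ++ ys) ≡ remove M xs ++ remove M ys
remove-++ M []       ys = refl
remove-++ M (u ∷ xs) ys with u ≡ᵇ M
... | true  = remove-++ M xs ys
... | false = cong (u ∷_) (remove-++ M xs ys)

remove-∉ : ∀ M xs → M ∉ xs → remove M xs ≡ xs
remove-∉ M []       _  = refl
remove-∉ M (u ∷ xs) M∉ rewrite ≢⇒≡ᵇ-false u M (λ u≡M → M∉ (here (sym u≡M))) = cong (u ∷_) (remove-∉ M xs (M∉ ∘ there))

remove-all : ∀ M xs → All (_≡ M) xs → remove M xs ≡ []
remove-all M []       []           = refl
remove-all M (u ∷ xs) (refl ∷ xs≡) rewrite ≡ᵇ-refl M = remove-all M xs xs≡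

insertion-remove : ∀ M s {w g} → g ∈ insertions s w → All (_≡ M) s → M ∉ w → remove M g ≡ w
insertion-remove M s {w} g∈ s≡M M∉ with ∈-insertions⁻ s w g∈
... | pre , suf , refl , refl
  rewrite remove-++ M pre (s ++ suf) | remove-++ M s suf | remove-all M s s≡M
        | remove-∉ M pre (M∉ ∘ ∈-++⁺ˡ) | remove-∉ M suf (M∉ ∘ ∈-++⁺ʳ pre) = refl

unique-insertions : ∀ M s′ w → M ∉ w → Unique (insertions (M ∷ s′) w)
unique-insertions M s′ []      _  = [] ∷ []
unique-insertions M s′ (u ∷ r) M∉ =
  All.tabulate (λ g∈ first≡ → let (_ , _ , g≡) = ∈-map⁻ (u ∷_) g∈ in
                  M∉ (here (trans (cong head-or-0 first≡) (cong head-or-0 g≡))))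
  ∷ Unique.map⁺ (λ { refl → refl }) (unique-insertions M s′ r (M∉ ∘ there))

record IsJSP (n : ℕ) (w : List ℕ) : Set where
  field
    length≡      : length w ≡ 3 * n
    letters      : ∀ {x} → x ∈ w → 0 < x × x ≤ 2 * n
    multiplicity : ∀ {v} → 0 < v → v ≤ 2 * n → count v w ≡ multM n v
    nested       : ∀ {i} → 0 < i → i ≤ n → ∀ {x} → x ∈ between (2 * i) w → 2 * i < x

∈-JSP⁻ : ∀ n {w} → w ∈ JSP n → IsJSP n w
∈-JSP⁻ n {w} w∈ = record
  { length≡      = proj₁ (∈-words⁻ (3 * n) (range (2 * n)) w∈words)
  ; letters      = ∈-range⁻ (2 * n) ∘ proj₂ (∈-words⁻ (3 * n) (range (2 * n)) w∈words)
  ; multiplicity = λ {v} 0<v v≤ → ℕ.≡ᵇ⇒≡ (count v w) (multM n v) (≡true⇒T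
      (all-∈⁻ (λ v → count v w ≡ᵇ multM n v) (range (2 * n)) perm-ok {v} (∈-range⁺ (2 * n) {v} 0<v v≤)))
  ; nested       = λ {i} 0<i i≤n {x} x∈ → ℕ.<ᵇ⇒< (2 * i) x (≡true⇒T
      (all-∈⁻ (2 * i <ᵇ_) (between (2 * i) w)
        (all-∈⁻ (λ i → all (2 * i <ᵇ_) (between (2 * i) w)) (range n) nested-ok {i} (∈-range⁺ n {i} 0<i i≤n)) x∈))
  }
  where
  w∈words×ok = ∈-filterᵇ⁻ (λ w → isPermM n w ∧ isJS n w) (words (3 * n) (range (2 * n))) w∈
  w∈words    = proj₁ w∈words×ok
  perm-ok    = proj₁ ∧-conical (isPermM n w) (isJS n w) (proj₂ w∈words×ok)
  nested-ok  = proj₂ ∧-conical (isPermM n w) (isJS n w) (proj₂ w∈words×ok)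
  ≡true⇒T : ∀ {b} → b ≡ true → T b
  ≡true⇒T = Equivalence.from T-≡

∈-JSP⁺ : ∀ n {w} → IsJSP n w → w ∈ JSP n
∈-JSP⁺ n {w} w-JSP = ∈-filterᵇ⁺ (λ w → isPermM n w ∧ isJS n w) (words (3 * n) (range (2 * n)))
  (∈-words⁺ (3 * n) (range (2 * n)) w length≡ (λ x∈ → let (0<x , x≤) = letters x∈ in ∈-range⁺ _ 0<x x≤))
  (cong₂ _∧_
    (all-∈⁺ _ (range (2 * n)) λ v∈ → let (0<v , v≤) = ∈-range⁻ _ v∈ in
      trans (cong (count _ w ≡ᵇ_) (sym (multiplicity 0<v v≤))) (≡ᵇ-refl (count _ w)))
    (all-∈⁺ _ (range n) λ i∈ → let (0<i , i≤n) = ∈-range⁻ n i∈ in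
      all-∈⁺ _ _ λ x∈ → <ᵇ-true (nested 0<i i≤n x∈)))
  where open IsJSP w-JSP

unique-JSP : ∀ n → Unique (JSP n)
unique-JSP n = unique-filterᵇ _ (unique-words (3 * n) (range (2 * n)) (unique-range (2 * n)))

2*suc : ∀ n → 2 * suc n ≡ suc (suc (2 * n))
2*suc n = ℕ.*-suc 2 n

multM-old : ∀ n {v} → v ≤ 2 * n → multM n v ≡ multM (suc n) v
multM-old n {v} v≤ rewrite <ᵇ-false (ℕ.≤⇒≯ v≤) | <ᵇ-false (ℕ.≤⇒≯ (ℕ.≤-trans v≤ (ℕ.*-monoʳ-≤ 2 (ℕ.n≤1+n n)))) = refl

odd%2 : ∀ n → suc (2 * n) % 2 ≡ 1
odd%2 n rewrite ℕ.*-comm 2 n = [m+kn]%n≡m%n 1 n 2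

even%2 : ∀ n → suc (suc (2 * n)) % 2 ≡ 0
even%2 n rewrite ℕ.*-comm 2 n = [m+kn]%n≡m%n 2 n 2

multM-barred : ∀ n → multM (suc n) (suc (2 * n)) ≡ 1
multM-barred n rewrite <ᵇ-false {2 * suc n} {suc (2 * n)} (ℕ.<-asym (subst (suc (2 * n) <_) (sym (2*suc n)) (ℕ.n<1+n _)))
                     | odd%2 n = refl

multM-unbarred : ∀ n → multM (suc n) (suc (suc (2 * n))) ≡ 2
multM-unbarred n rewrite <ᵇ-false {2 * suc n} {suc (suc (2 * n))} (ℕ.<-irrefl (2*suc n))
                       | even%2 n = refl

letter-cases : ∀ n {v} → v ≤ 2 * suc n → v ≤ 2 * n ⊎ v ≡ suc (2 * n) ⊎ v ≡ suc (suc (2 * n))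
letter-cases n v≤ rewrite 2*suc n with ℕ.m≤n⇒m<n∨m≡n v≤
... | inj₂ v≡ = inj₂ (inj₂ v≡)
... | inj₁ v< with ℕ.m≤n⇒m<n∨m≡n (ℕ.≤-pred v<)
...   | inj₂ v≡ = inj₂ (inj₁ v≡)
...   | inj₁ v<′ = inj₁ (ℕ.≤-pred v<′)

module Step (n : ℕ) where

  barred unbarred : ℕ
  barred   = suc (2 * n)
  unbarred = suc barred

  old<barred : ∀ {x} → x ≤ 2 * n → x < barred
  old<barred = s≤s

  old<unbarred : ∀ {x} → x ≤ 2 * n → x < unbarred
  old<unbarred x≤ = ℕ.m≤n⇒m≤1+n (s≤s x≤)

  barred≢unbarred : barred ≢ unbarred
  barred≢unbarred = ℕ.<⇒≢ (ℕ.n<1+n barred)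

  2*i≤2*n : ∀ {i} → i ≤ n → 2 * i ≤ 2 * n
  2*i≤2*n = ℕ.*-monoʳ-≤ 2

  count-after-insertions : ∀ {π w₁ w} → w₁ ∈ insertions [ barred ] π → w ∈ insertions (unbarred ∷ unbarred ∷ []) w₁ →
    ∀ v → count v w ≡ count v (unbarred ∷ unbarred ∷ []) + (count v [ barred ] + count v π)
  count-after-insertions w₁∈ w∈ v =
    trans (insertion-count _ w∈ v) (cong (count v (unbarred ∷ unbarred ∷ []) +_) (insertion-count _ w₁∈ v))

  module Insert {π w₁ w} (π-JSP : IsJSP n π) (w₁∈ : w₁ ∈ insertions [ barred ] π)
                (w∈ : w ∈ insertions (unbarred ∷ unbarred ∷ []) w₁) where
    open IsJSP π-JSP

    barred∉π : barred ∉ π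
    barred∉π x∈ = ℕ.<-irrefl refl (old<barred (proj₂ (letters x∈)))

    unbarred∉π : unbarred ∉ π
    unbarred∉π x∈ = ℕ.<-irrefl refl (old<unbarred (proj₂ (letters x∈)))

    w₁-letters : ∀ {x} → x ∈ w₁ → x ≡ barred ⊎ x ∈ π
    w₁-letters x∈ with insertion-∈⁻ [ barred ] w₁∈ x∈
    ... | inj₁ (here x≡) = inj₁ x≡
    ... | inj₂ x∈π       = inj₂ x∈π

    unbarred∉w₁ : unbarred ∉ w₁
    unbarred∉w₁ x∈ with w₁-letters x∈
    ... | inj₁ x≡   = barred≢unbarred (sym x≡)
    ... | inj₂ x∈π  = unbarred∉π x∈π

    w-letters : ∀ {x} → x ∈ w → x ≡ unbarred ⊎ x ∈ w₁
    w-letters x∈ with insertion-∈⁻ (unbarred ∷ unbarred ∷ []) w∈ x∈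
    ... | inj₁ (here x≡)         = inj₁ x≡
    ... | inj₁ (there (here x≡)) = inj₁ x≡
    ... | inj₂ x∈w₁              = inj₂ x∈w₁

    count-w : ∀ v → count v w ≡ count v (unbarred ∷ unbarred ∷ []) + (count v [ barred ] + count v π)
    count-w = count-after-insertions w₁∈ w∈

    length-w : length w ≡ 3 * suc n
    length-w = trans (insertion-length _ w∈)
      (trans (cong (2 +_) (trans (insertion-length _ w₁∈) (cong suc length≡))) (sym (ℕ.*-suc 3 n)))

    letters-w : ∀ {x} → x ∈ w → 0 < x × x ≤ 2 * suc n
    letters-w x∈ with w-letters x∈
    ... | inj₁ refl = ℕ.0<1+n , ℕ.≤-reflexive (sym (2*suc n))
    ... | inj₂ x∈w₁ with w₁-letters x∈w₁
    ...   | inj₁ refl = ℕ.0<1+n , ℕ.≤-trans (ℕ.n≤1+n barred) (ℕ.≤-reflexive (sym (2*suc n)))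
    ...   | inj₂ x∈π  = proj₁ (letters x∈π) , ℕ.≤-trans (proj₂ (letters x∈π)) (ℕ.*-monoʳ-≤ 2 (ℕ.n≤1+n n))

    multiplicity-w : ∀ {v} → 0 < v → v ≤ 2 * suc n → count v w ≡ multM (suc n) v
    multiplicity-w {v} 0<v v≤ with letter-cases n v≤
    ... | inj₁ v≤2n
      rewrite count-w v | count-∉ v _ (∉-double (ℕ.<⇒≢ (old<unbarred v≤2n)))
            | count-∉ v _ (∉-single (ℕ.<⇒≢ (old<barred v≤2n))) =
      trans (multiplicity 0<v v≤2n) (multM-old n v≤2n)
    ... | inj₂ (inj₁ refl)
      rewrite count-w barred | count-∉ barred _ (∉-double barred≢unbarred)
            | count-self barred | count-∉ barred π barred∉π = sym (multM-barred n)
    ... | inj₂ (inj₂ refl)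
      rewrite count-w unbarred | count-self² unbarred
            | count-∉ unbarred _ (∉-single (barred≢unbarred ∘ sym)) | count-∉ unbarred π unbarred∉π =
      sym (multM-unbarred n)

    between-w : ∀ {v} → v ≤ 2 * n → (∀ {x} → x ∈ between v π → v < x) → ∀ {x} → x ∈ between v w → v < x
    between-w v≤ above x∈ with insertion-between⁻ _ w∈ _ (∉-double (ℕ.<⇒≢ (old<unbarred v≤))) x∈
    ... | inj₂ (here refl)         = old<unbarred v≤
    ... | inj₂ (there (here refl)) = old<unbarred v≤
    ... | inj₁ x∈w₁ with insertion-between⁻ _ w₁∈ _ (∉-single (ℕ.<⇒≢ (old<barred v≤))) x∈w₁
    ...   | inj₂ (here refl) = old<barred v≤
    ...   | inj₁ x∈π         = above x∈π

    nested-w : ∀ {i} → 0 < i → i ≤ suc n → ∀ {x} → x ∈ between (2 * i) w → 2 * i < x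
    nested-w {i} 0<i i≤ {x} x∈ with ℕ.m≤n⇒m<n∨m≡n i≤
    ... | inj₁ i<1+n = between-w (2*i≤2*n (ℕ.≤-pred i<1+n)) (nested 0<i (ℕ.≤-pred i<1+n)) x∈
    ... | inj₂ refl with subst (x ∈_) (insertion-adjacent unbarred w∈ unbarred∉w₁)
                             (subst (λ v → x ∈ between v w) (2*suc n) x∈)
    ...   | ()

    result : IsJSP (suc n) w
    result = record { length≡ = length-w ; letters = letters-w ; multiplicity = multiplicity-w ; nested = nested-w }

  module Remove {w} (w-JSP : IsJSP (suc n) w) where
    open IsJSP w-JSP

    unbarred≤ : unbarred ≤ 2 * suc n
    unbarred≤ = ℕ.≤-reflexive (sym (2*suc n))

    barred≤ : barred ≤ 2 * suc n
    barred≤ = ℕ.≤-trans (ℕ.n≤1+n barred) unbarred≤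

    between-unbarred : between unbarred w ≡ []
    between-unbarred = all-absent λ {x} x∈ →
      ℕ.<-irrefl refl (ℕ.<-≤-trans (nested ℕ.0<1+n ℕ.≤-refl (subst (λ v → x ∈ between v w) (sym (2*suc n)) x∈))
                                    (proj₂ (letters (between-⊆ unbarred w x∈))))
      where
      all-absent : ∀ {l : List ℕ} → (∀ {x} → x ∈ l → ⊥) → l ≡ []
      all-absent {[]}    _      = refl
      all-absent {x ∷ l} absent = ⊥-elim (absent (here refl))

    split-unbarred = split-twice-adjacent unbarred w
      (trans (multiplicity ℕ.0<1+n unbarred≤) (multM-unbarred n)) between-unbarred

    w₁ : List ℕ
    w₁ = proj₁ split-unbarred ++ proj₁ (proj₂ split-unbarred)

    w∈ : w ∈ insertions (unbarred ∷ unbarred ∷ []) w₁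
    w∈ = subst (_∈ insertions (unbarred ∷ unbarred ∷ []) w₁) (sym (proj₂ (proj₂ split-unbarred)))
               (∈-insertions⁺ _ (proj₁ split-unbarred) (proj₁ (proj₂ split-unbarred)))

    split-barred = split-once barred w₁ (trans
      (sym (trans (insertion-count _ w∈ barred) (cong (_+ count barred w₁) (count-∉ barred _ (∉-double barred≢unbarred)))))
      (trans (multiplicity ℕ.0<1+n barred≤) (multM-barred n)))

    π : List ℕ
    π = proj₁ split-barred ++ proj₁ (proj₂ split-barred)

    w₁∈ : w₁ ∈ insertions [ barred ] π
    w₁∈ = subst (_∈ insertions [ barred ] π) (sym (proj₂ (proj₂ split-barred)))
                (∈-insertions⁺ _ (proj₁ split-barred) (proj₁ (proj₂ split-barred)))

    count-w : ∀ v → count v w ≡ count v (unbarred ∷ unbarred ∷ []) + (count v [ barred ] + count v π)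
    count-w = count-after-insertions w₁∈ w∈

    count-only-old : ∀ {v} → v ≤ 2 * n → count v w ≡ count v π
    count-only-old {v} v≤2n rewrite count-w v | count-∉ v _ (∉-double (ℕ.<⇒≢ (old<unbarred v≤2n)))
                                   | count-∉ v _ (∉-single (ℕ.<⇒≢ (old<barred v≤2n))) = refl

    barred∉π : barred ∉ π
    barred∉π = count≡0⇒∉ barred π (ℕ.suc-injective (begin
      suc (count barred π)
        ≡⟨ cong₂ (λ a b → a + (b + count barred π))
             (sym (count-∉ barred _ (∉-double barred≢unbarred))) (sym (count-self barred)) ⟩
      count barred (unbarred ∷ unbarred ∷ []) + (count barred [ barred ] + count barred π)
        ≡⟨ sym (count-w barred) ⟩
      count barred w
        ≡⟨ trans (multiplicity ℕ.0<1+n barred≤) (multM-barred n) ⟩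
      1 ∎))
      where open ≡-Reasoning

    unbarred∉π : unbarred ∉ π
    unbarred∉π = count≡0⇒∉ unbarred π (ℕ.suc-injective (ℕ.suc-injective (begin
      suc (suc (count unbarred π))
        ≡⟨ cong₂ (λ a b → a + (b + count unbarred π))
             (sym (count-self² unbarred)) (sym (count-∉ unbarred _ (∉-single (barred≢unbarred ∘ sym)))) ⟩
      count unbarred (unbarred ∷ unbarred ∷ []) + (count unbarred [ barred ] + count unbarred π)
        ≡⟨ sym (count-w unbarred) ⟩
      count unbarred w
        ≡⟨ trans (multiplicity ℕ.0<1+n unbarred≤) (multM-unbarred n) ⟩
      2 ∎)))
      where open ≡-Reasoning

    length-π : length π ≡ 3 * n
    length-π = ℕ.+-cancelˡ-≡ 3 _ _ (trans
      (sym (trans (insertion-length _ w∈) (cong (2 +_) (insertion-length _ w₁∈))))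
      (trans length≡ (ℕ.*-suc 3 n)))

    letters-π : ∀ {x} → x ∈ π → 0 < x × x ≤ 2 * n
    letters-π {x} x∈ with letters (insertion-∈⁺ _ w∈ (insertion-∈⁺ _ w₁∈ x∈))
    ... | 0<x , x≤ with letter-cases n x≤
    ...   | inj₁ x≤2n         = 0<x , x≤2n
    ...   | inj₂ (inj₁ refl) = ⊥-elim (barred∉π x∈)
    ...   | inj₂ (inj₂ refl) = ⊥-elim (unbarred∉π x∈)

    multiplicity-π : ∀ {v} → 0 < v → v ≤ 2 * n → count v π ≡ multM n v
    multiplicity-π 0<v v≤2n = trans (sym (count-only-old v≤2n))
      (trans (multiplicity 0<v (ℕ.≤-trans v≤2n (ℕ.*-monoʳ-≤ 2 (ℕ.n≤1+n n)))) (sym (multM-old n v≤2n)))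

    nested-π : ∀ {i} → 0 < i → i ≤ n → ∀ {x} → x ∈ between (2 * i) π → 2 * i < x
    nested-π 0<i i≤n x∈ = nested 0<i (ℕ.m≤n⇒m≤1+n i≤n)
      (insertion-between⁺ _ w∈ _ (∉-double (ℕ.<⇒≢ (old<unbarred (2*i≤2*n i≤n))))
        (insertion-between⁺ _ w₁∈ _ (∉-single (ℕ.<⇒≢ (old<barred (2*i≤2*n i≤n)))) x∈))

    π-JSP : IsJSP n π
    π-JSP = record { length≡ = length-π ; letters = letters-π ; multiplicity = multiplicity-π ; nested = nested-π }

  with-barred with-both : List (List ℕ)
  with-barred = concatMap (insertions [ barred ]) (JSP n)
  with-both   = concatMap (insertions (unbarred ∷ unbarred ∷ [])) with-barred

  JSP-below-barred : ∀ {π} → π ∈ JSP n → ∀ {x} → x ∈ π → x < barred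
  JSP-below-barred π∈ x∈ = old<barred (proj₂ (IsJSP.letters (∈-JSP⁻ n π∈) x∈))

  with-barred-below-unbarred : ∀ {w₁} → w₁ ∈ with-barred → ∀ {x} → x ∈ w₁ → x < unbarred
  with-barred-below-unbarred w₁∈ x∈ with ∈-concatMap⁻′ (insertions [ barred ]) (JSP n) w₁∈
  ... | π , π∈ , w₁∈π with insertion-∈⁻ [ barred ] w₁∈π x∈
  ...   | inj₁ (here refl) = ℕ.≤-refl
  ...   | inj₂ x∈π         = ℕ.m≤n⇒m≤1+n (JSP-below-barred π∈ x∈π)

  unique-with-barred : Unique with-barred
  unique-with-barred = unique-concatMap (insertions [ barred ]) (remove barred) (unique-JSP n)
    (λ π∈ → unique-insertions barred [] _ (λ x∈ → ℕ.<-irrefl refl (JSP-below-barred π∈ x∈)))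
    (λ π∈ w₁∈ → insertion-remove barred [ barred ] w₁∈ (refl ∷ []) (λ x∈ → ℕ.<-irrefl refl (JSP-below-barred π∈ x∈)))

  unique-with-both : Unique with-both
  unique-with-both = unique-concatMap (insertions (unbarred ∷ unbarred ∷ [])) (remove unbarred) unique-with-barred
    (λ w₁∈ → unique-insertions unbarred [ unbarred ] _ (λ x∈ → ℕ.<-irrefl refl (with-barred-below-unbarred w₁∈ x∈)))
    (λ w₁∈ w∈ → insertion-remove unbarred (unbarred ∷ unbarred ∷ []) w∈ (refl ∷ refl ∷ [])
                  (λ x∈ → ℕ.<-irrefl refl (with-barred-below-unbarred w₁∈ x∈)))

  JSP-suc⊆ : ∀ {w} → w ∈ JSP (suc n) → w ∈ with-both
  JSP-suc⊆ w∈ = ∈-concatMap⁺′ _ (∈-concatMap⁺′ _ (∈-JSP⁺ n R.π-JSP) R.w₁∈) R.w∈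
    where module R = Remove (∈-JSP⁻ (suc n) w∈)

  JSP-suc⊇ : ∀ {w} → w ∈ with-both → w ∈ JSP (suc n)
  JSP-suc⊇ w∈ with ∈-concatMap⁻′ _ with-barred w∈
  ... | w₁ , w₁∈ , w∈w₁ with ∈-concatMap⁻′ _ (JSP n) w₁∈
  ...   | π , π∈ , w₁∈π = ∈-JSP⁺ (suc n) (Insert.result (∈-JSP⁻ n π∈) w₁∈π w∈w₁)

  JSP-suc↭ : JSP (suc n) ↭ with-both
  JSP-suc↭ = ∼bag⇒↭ (unique∧set⇒bag (unique-JSP (suc n)) unique-with-both (mk⇔ JSP-suc⊆ JSP-suc⊇))

stats-JSP-suc : ∀ n → map stats (JSP (suc n)) ↭ derive (1 , 1 , 1) (derive (1 , 1 , 0) (map stats (JSP n)))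
stats-JSP-suc n = begin
  map stats (JSP (suc n))
    ↭⟨ map⁺ stats JSP-suc↭ ⟩
  map stats with-both
    ↭⟨ stats-insertions (double-block unbarred) ℕ.0<1+n with-barred
         (All.tabulate λ w₁∈ → All.tabulate (with-barred-below-unbarred w₁∈)) ⟩
  derive (1 , 1 , 1) (map stats with-barred)
    ↭⟨ derive-↭ (1 , 1 , 1) (stats-insertions (single-block barred) ℕ.0<1+n (JSP n)
         (All.tabulate λ π∈ → All.tabulate (JSP-below-barred π∈))) ⟩
  derive (1 , 1 , 1) (derive (1 , 1 , 0) (map stats (JSP n))) ∎
  where
  open PermutationReasoning
  open Step n

S≗series : ∀ n → S n ≗₃ toPoly (series (map stats (JSP n)))
S≗series n a b c = cong ℕtoℚ (length-filterᵇ-isAt stats (JSP n) a b c)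

iterD₂D₁-Z : ∀ n → iterD₂D₁ n Z ≗₃ toPoly (series (map stats (JSP n)))
iterD₂D₁-Z zero    = mono≗series 0 0 1
iterD₂D₁-Z (suc n) =
  ≗₃-trans (D₂.derivation-cong (D₁.derivation-cong (iterD₂D₁-Z n)))
  (≗₃-trans (D₂.derivation-cong (D₁-series (map stats (JSP n))))
  (≗₃-trans (D₂-series (derive (1 , 1 , 0) (map stats (JSP n))))
  λ a b c → cong ℕtoℚ (series-↭ (↭-sym (stats-JSP-suc n)) a b c)))

D₁-variable : ∀ {i j k} → IsUnit (i , j , k) → D₁ (mono i j k) ≗₃ toPoly (series [ (1 , 1 , 0) ])
D₁-variable unitˣ = ≗₃-trans (D₁.derivation-cong (mono≗series 1 0 0)) (D₁-series [ (1 , 0 , 0) ])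
D₁-variable unitʸ = ≗₃-trans (D₁.derivation-cong (mono≗series 0 1 0)) (D₁-series [ (0 , 1 , 0) ])
D₁-variable unitᶻ = ≗₃-trans (D₁.derivation-cong (mono≗series 0 0 1)) (D₁-series [ (0 , 0 , 1) ])

iterD₂D₁-suc-cong : ∀ {f g} → D₁ f ≗₃ D₁ g → ∀ m → iterD₂D₁ (suc m) f ≗₃ iterD₂D₁ (suc m) g
iterD₂D₁-suc-cong D₁f≗D₁g zero    = D₂.derivation-cong D₁f≗D₁g
iterD₂D₁-suc-cong D₁f≗D₁g (suc m) = D₂.derivation-cong (D₁.derivation-cong (iterD₂D₁-suc-cong D₁f≗D₁g m))

lemma13 : (n : ℕ) → 1 ≤ n → (a b c : ℕ) →
    (iterD₂D₁ n X a b c ≡ S n a b c) × (iterD₂D₁ n Y a b c ≡ S n a b c) × (iterD₂D₁ n Z a b c ≡ S n a b c)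
lemma13 zero    ()
lemma13 (suc m) _ a b c = like-Z unitˣ , like-Z unitʸ , Z-case
  where
  Z-case : iterD₂D₁ (suc m) Z a b c ≡ S (suc m) a b c
  Z-case = trans (iterD₂D₁-Z (suc m) a b c) (sym (S≗series (suc m) a b c))

  like-Z : ∀ {i j k} → IsUnit (i , j , k) → iterD₂D₁ (suc m) (mono i j k) a b c ≡ S (suc m) a b c
  like-Z unit = trans (iterD₂D₁-suc-cong (≗₃-trans (D₁-variable unit) (≗₃-sym (D₁-variable unitᶻ))) m a b c) Z-case
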